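{- Let $f$ be a partial $2$-tone edge $7$-coloring of a subcubic graph $G$, and let $e$ be an uncolored edge of $G$. If one end of $e$ has degree one in $G$, then $f$ can be extended to $e$.
   Context: All graphs are simple and finite; subcubic means maximum degree at most $3$. The distance $d_G(e,e')$ between edges is the distance between the corresponding vertices in the line graph $L(G)$. A partial $2$-tone edge $k$-coloring of $G$ is a map $f:E'\to\binom{\{1,\dots,k\}}{2}$ for some $E'\subseteq E(G)$ such that for all distinct $e,e'\in E'$, $|f(e)\cap f(e')|<d_G(e,e')$; edges outside $E'$ are uncolored. Extending $f$ to $e$ means assigning $e$ a label so that the result is again a partial $2$-tone edge $k$-coloring. -}

module Defs where

open import Data.Nat using (ℕ; zero; suc; _≤_; _<_)
open import Data.Fin using (Fin; toℕ)
open import Data.Fin.Subset using (Subset; ∣_∣; _∩_)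
open import Data.Bool using (Bool; true; false; if_then_else_)
open import Data.Product using (Σ; Σ-syntax; _×_; _,_; proj₁)
open import Data.Maybe using (Maybe; just; nothing)
open import Data.List using (List; filter; length)
open import Data.List using (allFin)
open import Relation.Binary.PropositionalEquality using (_≡_; _≢_)
open import Relation.Nullary using (¬_; Dec; yes; no; _×-dec_)
open import Relation.Nullary.Decidable using (⌊_⌋)
import Data.Fin.Properties as FinP
open import Data.Bool.Properties using () renaming (_≟_ to _≟B_)

record Graph : Set where
  field
    n     : ℕ
    adj   : Fin n → Fin n → Bool
    sym   : ∀ u v → adj u v ≡ adj v u
    irr   : ∀ u → adj u u ≡ false
open Graph public

deg : (G : Graph) → Fin (n G) → ℕ
deg G u = length (filter (λ v → adj G u v ≟B true) (allFin (n G)))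

Subcubic : Graph → Set
Subcubic G = ∀ u → deg G u ≤ 3

-- An edge is an unordered pair {u,v} of adjacent vertices, stored with
-- toℕ u < toℕ v (so each edge has exactly one representation).
record Edge (G : Graph) : Set where
  constructor edge
  field
    fst  : Fin (n G)
    snd  : Fin (n G)
    ord  : toℕ fst < toℕ snd
    isE  : adj G fst snd ≡ true
open Edge public

SameEdge : {G : Graph} → Edge G → Edge G → Set
SameEdge e e' = (fst e ≡ fst e') × (snd e ≡ snd e')

sameEdge? : {G : Graph} → (e e' : Edge G) → Dec (SameEdge e e')
sameEdge? e e' = (fst e FinP.≟ fst e') ×-dec (snd e FinP.≟ snd e')

ShareEnd : {G : Graph} → Edge G → Edge G → Set
ShareEnd e e' = (fst e ≡ fst e') Data.Sum.⊎ ((fst e ≡ snd e') Data.Sum.⊎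
                ((snd e ≡ fst e') Data.Sum.⊎ (snd e ≡ snd e')))
  where import Data.Sum

LAdj : {G : Graph} → Edge G → Edge G → Set
LAdj e e' = ¬ SameEdge e e' × ShareEnd e e'

data LWalk {G : Graph} : Edge G → Edge G → ℕ → Set where
  here : ∀ {e e'} → SameEdge e e' → LWalk e e' zero
  step : ∀ {e e₁ e' k} → LAdj e e₁ → LWalk e₁ e' k → LWalk e e' (suc k)

-- d_G(e,e') ≤ k  (distance in the line graph; false for all k if
-- e and e' lie in different components, i.e. distance ∞)
DistLE : {G : Graph} → Edge G → Edge G → ℕ → Set
DistLE e e' k = Σ[ j ∈ ℕ ] (j ≤ k × LWalk e e' j)

-- labels: 2-element subsets of {1,…,k}, modelled as subsets of Fin k
Label : ℕ → Set
Label k = Σ[ s ∈ Subset k ] (∣ s ∣ ≡ 2)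

PartialLabelling : Graph → ℕ → Set
PartialLabelling G k = Edge G → Maybe (Label k)

-- partial 2-tone edge k-coloring:
-- for distinct colored e,e':  |f(e) ∩ f(e')| < d_G(e,e'),
-- i.e. NOT d_G(e,e') ≤ |f(e) ∩ f(e')|
IsPartial2Tone : {G : Graph} {k : ℕ} → PartialLabelling G k → Set
IsPartial2Tone {G} {k} f =
  ∀ (e e' : Edge G) (L L' : Label k) → ¬ SameEdge e e' →
    f e ≡ just L → f e' ≡ just L' →
    ¬ DistLE e e' ∣ proj₁ L ∩ proj₁ L' ∣

assign : {G : Graph} {k : ℕ} → PartialLabelling G k → Edge G → Label k →
         PartialLabelling G k
assign f e L e' with sameEdge? e e'
... | yes _ = just L
... | no  _ = f e'

Extendable : {G : Graph} {k : ℕ} → PartialLabelling G k → Edge G → Set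
Extendable {G} {k} f e = Σ[ L ∈ Label k ] IsPartial2Tone (assign f e L)

-- Let e = uv with u a leaf. The edges at distance one from e are the at most two other
-- edges vwᵢ at v; their labels use at most four colours, so at least three colours a, b, c
-- are still free. The edges at distance two are the other edges at the far ends wᵢ, and
-- such an edge conflicts with a label for e only if it carries exactly that label. Edges
-- at a common vertex have disjoint labels, so the labels at wᵢ contain at most one of the
-- pairs ab, ac, bc; hence one of the three pairs survives both w₁ and w₂.

module Submission where

open import Axiom.UniquenessOfIdentityProofs using (module Decidable⇒UIP)
open import Data.Bool using (true)
open import Data.Bool.Properties using () renaming (_≟_ to _≟ᵇ_)
open import Data.Empty using (⊥; ⊥-elim)
open import Data.Fin using (Fin; zero; suc; toℕ)
open import Data.Fin.Properties using (toℕ-injective; any?)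
open import Data.Fin.Subset using (Subset; inside; outside; _∈_; _∉_; _∪_; _∩_; ⁅_⁆; ∣_∣; Empty)
  renaming (⊥ to ∅)
open import Data.Fin.Subset.Properties
  using ( _∈?_; drop-there; ∉⊥; ∣⊥∣≡0; x∈⁅x⁆; x∈⁅y⁆⇒x≡y; x∉⁅y⁆⇒x≢y; ∣⁅x⁆∣≡1; Empty-unique
        ; p⊆p∪q; q⊆p∪q; x∈p∪q⁻; x∈p∩q⁺; x∈p∩q⁻; p∩q⊆p; ∩-comm; ∣p∩q∣≤∣p∣
        ; p⊂q⇒∣p∣<∣q∣; x∈p∧x≢y⇒x∈p-y; x∈p⇒∣p-x∣<∣p∣ )
open import Data.List using (List; []; _∷_; length; filter; allFin)
open import Data.List.Membership.Propositional using () renaming (_∈_ to _∈ₗ_)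
open import Data.List.Membership.Propositional.Properties using (∈-filter⁺; ∈-filter⁻; ∈-allFin)
open import Data.List.Relation.Unary.Any using (here; there)
open import Data.Maybe using (Maybe; just; nothing)
open import Data.Maybe.Properties using (just-injective)
open import Data.Nat using (ℕ; zero; suc; _+_; _≤_; _<_; z≤n; s≤s)
open import Data.Nat.Properties
  using ( ≤-refl; ≤-reflexive; ≤-antisym; ≤-trans; <-≤-trans; <-cmp; <-asym; <-irrelevant; <⇒≱; ≤⇒≯
        ; n≤1+n; m≤n+m; m<n⇒m<1+n; +-comm; +-suc; +-monoʳ-≤; +-mono-≤ )
open import Data.Product using (Σ-syntax; ∃-syntax; _×_; _,_; proj₁; proj₂)
open import Data.Vec using ([]; _∷_)
open import Data.Sum using (_⊎_; inj₁; inj₂)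
open import Function using (_∘_)
open import Relation.Binary.Definitions using (Decidable; Symmetric; tri<; tri≈; tri>)
open import Relation.Binary.PropositionalEquality using (_≡_; _≢_; refl; sym; trans; cong; cong₂; subst)
open import Relation.Nullary using (¬_; yes; no; _×-dec_)

open import Defs hiding (sym)

private
  variable
    k : ℕ

∣p∪q∣≤∣p∣+∣q∣ : (p q : Subset k) → ∣ p ∪ q ∣ ≤ ∣ p ∣ + ∣ q ∣
∣p∪q∣≤∣p∣+∣q∣ []            []            = z≤n
∣p∪q∣≤∣p∣+∣q∣ (outside ∷ p) (outside ∷ q) = ∣p∪q∣≤∣p∣+∣q∣ p q
∣p∪q∣≤∣p∣+∣q∣ (outside ∷ p) (inside ∷ q)  =
  ≤-trans (s≤s (∣p∪q∣≤∣p∣+∣q∣ p q)) (≤-reflexive (sym (+-suc ∣ p ∣ ∣ q ∣)))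
∣p∪q∣≤∣p∣+∣q∣ (inside ∷ p)  (outside ∷ q) = s≤s (∣p∪q∣≤∣p∣+∣q∣ p q)
∣p∪q∣≤∣p∣+∣q∣ (inside ∷ p)  (inside ∷ q)  =
  s≤s (≤-trans (∣p∪q∣≤∣p∣+∣q∣ p q) (+-monoʳ-≤ ∣ p ∣ (n≤1+n ∣ q ∣)))

∣p∪⁅x⁆∣≤1+∣p∣ : (p : Subset k) (x : Fin k) → ∣ p ∪ ⁅ x ⁆ ∣ ≤ suc ∣ p ∣
∣p∪⁅x⁆∣≤1+∣p∣ p x = ≤-trans (∣p∪q∣≤∣p∣+∣q∣ p ⁅ x ⁆)
  (≤-reflexive (trans (cong (∣ p ∣ +_) (∣⁅x⁆∣≡1 x)) (+-comm ∣ p ∣ 1)))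

x∉p∪⁅y⁆⇒x∉p×x≢y : {p : Subset k} {x y : Fin k} → x ∉ p ∪ ⁅ y ⁆ → x ∉ p × x ≢ y
x∉p∪⁅y⁆⇒x∉p×x≢y {p = p} {y = y} x∉ =
  x∉ ∘ p⊆p∪q ⁅ y ⁆ , x∉⁅y⁆⇒x≢y (x∉ ∘ q⊆p∪q p ⁅ y ⁆)

∣p∣<k⇒∃∉p : (p : Subset k) → ∣ p ∣ < k → ∃[ x ] x ∉ p
∣p∣<k⇒∃∉p (outside ∷ p) _         = zero , λ ()
∣p∣<k⇒∃∉p (inside ∷ p)  (s≤s ∣p∣<k) =
  let x , x∉p = ∣p∣<k⇒∃∉p p ∣p∣<k in suc x , x∉p ∘ drop-there

three-outside : (p : Subset k) → 3 + ∣ p ∣ ≤ k →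
  ∃[ a ] ∃[ b ] ∃[ c ] (a ≢ b × a ≢ c × b ≢ c × a ∉ p × b ∉ p × c ∉ p)
three-outside p 3+∣p∣≤k =
  let a , a∉p  = ∣p∣<k⇒∃∉p p (≤-trans (m≤n+m _ 2) 3+∣p∣≤k)
      b , b∉pa = ∣p∣<k⇒∃∉p (p ∪ ⁅ a ⁆) (≤-trans (s≤s (∣p∪⁅x⁆∣≤1+∣p∣ p a)) (≤-trans (m≤n+m _ 1) 3+∣p∣≤k))
      c , c∉pab = ∣p∣<k⇒∃∉p ((p ∪ ⁅ a ⁆) ∪ ⁅ b ⁆)
        (≤-trans (s≤s (≤-trans (∣p∪⁅x⁆∣≤1+∣p∣ (p ∪ ⁅ a ⁆) b) (s≤s (∣p∪⁅x⁆∣≤1+∣p∣ p a)))) 3+∣p∣≤k)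
      b∉p , b≢a = x∉p∪⁅y⁆⇒x∉p×x≢y b∉pa
      c∉pa , c≢b = x∉p∪⁅y⁆⇒x∉p×x≢y c∉pab
      c∉p , c≢a = x∉p∪⁅y⁆⇒x∉p×x≢y c∉pa
  in a , b , c , b≢a ∘ sym , c≢a ∘ sym , c≢b ∘ sym , a∉p , b∉p , c∉p

x∈p⇒0<∣p∣ : {p : Subset k} {x : Fin k} → x ∈ p → 0 < ∣ p ∣
x∈p⇒0<∣p∣ x∈p = ≤-trans (s≤s z≤n) (x∈p⇒∣p-x∣<∣p∣ x∈p)

distinct₂⇒2≤∣p∣ : {p : Subset k} {x y : Fin k} → x ∈ p → y ∈ p → x ≢ y → 2 ≤ ∣ p ∣
distinct₂⇒2≤∣p∣ x∈p y∈p x≢y =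
  ≤-trans (s≤s (x∈p⇒0<∣p∣ (x∈p∧x≢y⇒x∈p-y y∈p (x≢y ∘ sym)))) (x∈p⇒∣p-x∣<∣p∣ x∈p)

distinct₃⇒3≤∣p∣ : {p : Subset k} {x y z : Fin k} → x ∈ p → y ∈ p → z ∈ p →
                  x ≢ y → x ≢ z → y ≢ z → 3 ≤ ∣ p ∣
distinct₃⇒3≤∣p∣ x∈p y∈p z∈p x≢y x≢z y≢z =
  ≤-trans (s≤s (distinct₂⇒2≤∣p∣ (x∈p∧x≢y⇒x∈p-y y∈p (x≢y ∘ sym)) (x∈p∧x≢y⇒x∈p-y z∈p (x≢z ∘ sym)) y≢z))
          (x∈p⇒∣p-x∣<∣p∣ x∈p)

x∈p∧x∉q⇒∣p∩q∣<∣p∣ : {p q : Subset k} {x : Fin k} → x ∈ p → x ∉ q → ∣ p ∩ q ∣ < ∣ p ∣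
x∈p∧x∉q⇒∣p∩q∣<∣p∣ {p = p} {q} x∈p x∉q =
  p⊂q⇒∣p∣<∣q∣ (p∩q⊆p p q , _ , x∈p , x∉q ∘ proj₂ ∘ x∈p∩q⁻ p q)

pair : Fin k → Fin k → Subset k
pair a b = ⁅ a ⁆ ∪ ⁅ b ⁆

a∈pair : (a b : Fin k) → a ∈ pair a b
a∈pair a b = p⊆p∪q ⁅ b ⁆ (x∈⁅x⁆ a)

b∈pair : (a b : Fin k) → b ∈ pair a b
b∈pair a b = q⊆p∪q ⁅ a ⁆ ⁅ b ⁆ (x∈⁅x⁆ b)

∈-pair⁻ : {a b x : Fin k} → x ∈ pair a b → x ≡ a ⊎ x ≡ b
∈-pair⁻ {a = a} {b} x∈ with x∈p∪q⁻ ⁅ a ⁆ ⁅ b ⁆ x∈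
... | inj₁ x∈⁅a⁆ = inj₁ (x∈⁅y⁆⇒x≡y a x∈⁅a⁆)
... | inj₂ x∈⁅b⁆ = inj₂ (x∈⁅y⁆⇒x≡y b x∈⁅b⁆)

∣pair∣≡2 : {a b : Fin k} → a ≢ b → ∣ pair a b ∣ ≡ 2
∣pair∣≡2 {a = a} {b} a≢b = ≤-antisym
  (≤-trans (∣p∪q∣≤∣p∣+∣q∣ ⁅ a ⁆ ⁅ b ⁆) (≤-reflexive (cong₂ _+_ (∣⁅x⁆∣≡1 a) (∣⁅x⁆∣≡1 b))))
  (distinct₂⇒2≤∣p∣ (a∈pair a b) (b∈pair a b) a≢b)

pair-disjoint : {p : Subset k} {a b : Fin k} → a ∉ p → b ∉ p → ∣ pair a b ∩ p ∣ ≡ 0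
pair-disjoint {k = k} {p} {a} {b} a∉p b∉p = trans (cong ∣_∣ (Empty-unique empty)) (∣⊥∣≡0 k)
  where
  empty : Empty (pair a b ∩ p)
  empty (x , x∈) with x∈pair , x∈p ← x∈p∩q⁻ (pair a b) p x∈ with ∈-pair⁻ x∈pair
  ... | inj₁ refl = a∉p x∈p
  ... | inj₂ refl = b∉p x∈p

Covers : Subset k → Fin k → Fin k → Set
Covers p x y = x ∈ p × y ∈ p

¬Covers⇒∣pair∩p∣<2 : {p : Subset k} {a b : Fin k} → a ≢ b → ¬ Covers p a b → ∣ pair a b ∩ p ∣ < 2
¬Covers⇒∣pair∩p∣<2 {p = p} {a} {b} a≢b ¬covers with a ∈? p | b ∈? p
... | yes a∈p | yes b∈p = ⊥-elim (¬covers (a∈p , b∈p))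
... | no a∉p  | _       = <-≤-trans (x∈p∧x∉q⇒∣p∩q∣<∣p∣ (a∈pair a b) a∉p) (≤-reflexive (∣pair∣≡2 a≢b))
... | yes _   | no b∉p  = <-≤-trans (x∈p∧x∉q⇒∣p∩q∣<∣p∣ (b∈pair a b) b∉p) (≤-reflexive (∣pair∣≡2 a≢b))

IsMatching : {A : Set} → (A → A → Set) → Set
IsMatching R = ∀ {x y z} → x ≢ y → x ≢ z → y ≢ z → R x y → R x z → ⊥

record UncoveredSide {A : Set} (P : A → Set) (R S : A → A → Set) : Set where
  constructor side
  field
    {a b} : A
    a≢b   : a ≢ b
    Pa    : P a
    Pb    : P b
    ¬Rab  : ¬ R a b
    ¬Sab  : ¬ S a b

module _ {A : Set} {P : A → Set} {R S : A → A → Set}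
         (R? : Decidable R) (S? : Decidable S) (R-sym : Symmetric R) (S-sym : Symmetric S)
         (R-matching : IsMatching R) (S-matching : IsMatching S) where

  uncoveredSide : {a b c : A} → P a → P b → P c → a ≢ b → a ≢ c → b ≢ c → UncoveredSide P R S
  -- Each matching covers at most one side of the triangle a b c, so two of them leave a
  -- side uncovered.
  uncoveredSide {a} {b} {c} Pa Pb Pc a≢b a≢c b≢c with R? a b | S? a b
  ... | no ¬Rab | no ¬Sab = side a≢b Pa Pb ¬Rab ¬Sab
  ... | yes Rab | _ with S? a c
  ...   | no ¬Sac = side a≢c Pa Pc (R-matching a≢b a≢c b≢c Rab) ¬Sac
  ...   | yes Sac = side b≢c Pb Pc (R-matching (a≢b ∘ sym) b≢c a≢c (R-sym Rab))
                                   (S-matching (a≢c ∘ sym) (b≢c ∘ sym) a≢b (S-sym Sac) ∘ S-sym)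
  uncoveredSide {a} {b} {c} Pa Pb Pc a≢b a≢c b≢c | no ¬Rab | yes Sab with R? a c
  ...   | no ¬Rac = side a≢c Pa Pc ¬Rac (S-matching a≢b a≢c b≢c Sab)
  ...   | yes Rac = side b≢c Pb Pc (R-matching (a≢c ∘ sym) (b≢c ∘ sym) a≢b (R-sym Rac) ∘ R-sym)
                                   (S-matching (a≢b ∘ sym) b≢c a≢c (S-sym Sab))

CoveredBy : {I : Set} → (I → Subset k) → Fin k → Fin k → Set
CoveredBy T x y = ∃[ i ] Covers (T i) x y

coveredBy? : {m : ℕ} (T : Fin m → Subset k) → Decidable (CoveredBy T)
coveredBy? T x y = any? λ i → x ∈? T i ×-dec y ∈? T i

coveredBy-sym : {I : Set} {T : I → Subset k} → Symmetric (CoveredBy T)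
coveredBy-sym (i , x∈ , y∈) = i , y∈ , x∈

coveredBy-matching : {I : Set} {T : I → Subset k} → (∀ i → ∣ T i ∣ ≤ 2) →
                     (∀ i j → T i ≡ T j ⊎ Empty (T i ∩ T j)) → IsMatching (CoveredBy T)
coveredBy-matching {T = T} ∣T∣≤2 equal-or-disjoint x≢y x≢z y≢z (i , x∈Ti , y∈Ti) (j , x∈Tj , z∈Tj)
  with equal-or-disjoint i j
... | inj₁ Ti≡Tj = ≤⇒≯ (∣T∣≤2 i) (distinct₃⇒3≤∣p∣ x∈Ti y∈Ti (subst (_ ∈_) (sym Ti≡Tj) z∈Tj) x≢y x≢z y≢z)
... | inj₂ disjoint = disjoint (_ , x∈p∩q⁺ (x∈Ti , x∈Tj))

module _ {A : Set} where

  ∈-length1⇒≡ : {xs : List A} {x y : A} → length xs ≡ 1 → x ∈ₗ xs → y ∈ₗ xs → x ≡ y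
  ∈-length1⇒≡ {xs = _ ∷ []} _ (here refl) (here refl) = refl

  atMostTwoOthers : {z : A} (xs : List A) → length xs ≤ 3 → z ∈ₗ xs →
    Σ[ y ∈ (Fin 2 → A) ] ((∀ i → y i ∈ₗ xs) × (∀ {x} → x ∈ₗ xs → x ≢ z → ∃[ i ] x ≡ y i))
  atMostTwoOthers (a ∷ []) _ _ = (λ _ → a) , (λ _ → here refl) , λ { (here refl) _ → zero , refl }
  atMostTwoOthers (a ∷ b ∷ []) _ _ =
      (λ { zero → a ; (suc _) → b })
    , (λ { zero → here refl ; (suc _) → there (here refl) })
    , λ { (here refl) _ → zero , refl ; (there (here refl)) _ → suc zero , refl }
  atMostTwoOthers (a ∷ b ∷ c ∷ []) _ (here refl) =
      (λ { zero → b ; (suc _) → c })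
    , (λ { zero → there (here refl) ; (suc _) → there (there (here refl)) })
    , λ { (here refl) a≢a → ⊥-elim (a≢a refl)
        ; (there (here refl)) _ → zero , refl
        ; (there (there (here refl))) _ → suc zero , refl }
  atMostTwoOthers (a ∷ b ∷ c ∷ []) _ (there (here refl)) =
      (λ { zero → a ; (suc _) → c })
    , (λ { zero → here refl ; (suc _) → there (there (here refl)) })
    , λ { (here refl) _ → zero , refl
        ; (there (here refl)) b≢b → ⊥-elim (b≢b refl)
        ; (there (there (here refl))) _ → suc zero , refl }
  atMostTwoOthers (a ∷ b ∷ c ∷ []) _ (there (there (here refl))) =
      (λ { zero → a ; (suc _) → b })
    , (λ { zero → here refl ; (suc _) → there (here refl) })
    , λ { (here refl) _ → zero , refl
        ; (there (here refl)) _ → suc zero , refl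
        ; (there (there (here refl))) c≢c → ⊥-elim (c≢c refl) }
  atMostTwoOthers (_ ∷ _ ∷ _ ∷ _ ∷ _) (s≤s (s≤s (s≤s ()))) _

Vertex : Graph → Set
Vertex G = Fin (n G)

module _ {G : Graph} where

  private
    variable
      e e′ e₁ e₂ ε : Edge G
      u v x y z : Vertex G

  data Joins (e : Edge G) (x y : Vertex G) : Set where
    forwards  : fst e ≡ x → snd e ≡ y → Joins e x y
    backwards : fst e ≡ y → snd e ≡ x → Joins e x y

  data Incident (e : Edge G) (x : Vertex G) : Set where
    at-fst : fst e ≡ x → Incident e x
    at-snd : snd e ≡ x → Incident e x

  adj-sym : adj G x y ≡ true → adj G y x ≡ true
  adj-sym {x = x} {y = y} xy = trans (Graph.sym G y x) xy

  adj⇒≢ : adj G x y ≡ true → x ≢ y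
  adj⇒≢ {x = x} xx refl with () ← trans (sym (irr G x)) xx

  SameEdge⇒≡ : SameEdge e e′ → e ≡ e′
  SameEdge⇒≡ {e = edge x y _ _} {e′ = edge .x .y _ _} (refl , refl) =
    cong₂ (edge x y) (<-irrelevant _ _) (Decidable⇒UIP.≡-irrelevant _≟ᵇ_ _ _)

  ≡⇒SameEdge : e ≡ e′ → SameEdge e e′
  ≡⇒SameEdge refl = refl , refl

  ¬SameEdge⇒≢ : ¬ SameEdge e e′ → e′ ≢ e
  ¬SameEdge⇒≢ ¬same e′≡e = ¬same (≡⇒SameEdge (sym e′≡e))

  SameEdge-sym : SameEdge e e′ → SameEdge e′ e
  SameEdge-sym (p , q) = sym p , sym q

  joins-unique : Joins e x y → Joins e′ x y → e ≡ e′
  joins-unique {e = edge _ _ _ _} {e′ = edge _ _ _ _} (forwards refl refl) (forwards refl refl) =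
    SameEdge⇒≡ (refl , refl)
  joins-unique {e = edge _ _ _ _} {e′ = edge _ _ _ _} (backwards refl refl) (backwards refl refl) =
    SameEdge⇒≡ (refl , refl)
  joins-unique {e = edge _ _ x<y _} {e′ = edge _ _ y<x _} (forwards refl refl) (backwards refl refl) =
    ⊥-elim (<-asym x<y y<x)
  joins-unique {e = edge _ _ y<x _} {e′ = edge _ _ x<y _} (backwards refl refl) (forwards refl refl) =
    ⊥-elim (<-asym x<y y<x)

  joins-adj : Joins e x y → adj G x y ≡ true
  joins-adj {e = e} (forwards refl refl) = isE e
  joins-adj {e = e} (backwards refl refl) = adj-sym (isE e)

  joiningEdge : adj G x y ≡ true → Σ[ e ∈ Edge G ] Joins e x y
  joiningEdge {x = x} {y = y} xy with <-cmp (toℕ x) (toℕ y)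
  ... | tri< x<y _ _ = edge x y x<y xy , forwards refl refl
  ... | tri≈ _ x≡y _ = ⊥-elim (adj⇒≢ xy (toℕ-injective x≡y))
  ... | tri> _ _ y<x = edge y x y<x (adj-sym xy) , backwards refl refl

  joins⇒incidentˡ : Joins e x y → Incident e x
  joins⇒incidentˡ (forwards p _) = at-fst p
  joins⇒incidentˡ (backwards _ q) = at-snd q

  joins⇒incidentʳ : Joins e x y → Incident e y
  joins⇒incidentʳ (forwards _ q) = at-snd q
  joins⇒incidentʳ (backwards p _) = at-fst p

  otherEnd : Incident e x → ∃[ y ] Joins e x y
  otherEnd {e = e} (at-fst refl) = snd e , forwards refl refl
  otherEnd {e = e} (at-snd refl) = fst e , backwards refl refl

  incident⇒end : Joins e x y → Incident e z → z ≡ x ⊎ z ≡ y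
  incident⇒end (forwards refl refl) (at-fst refl) = inj₁ refl
  incident⇒end (forwards refl refl) (at-snd refl) = inj₂ refl
  incident⇒end (backwards refl refl) (at-fst refl) = inj₂ refl
  incident⇒end (backwards refl refl) (at-snd refl) = inj₁ refl

  commonEnd : ShareEnd e e′ → ∃[ x ] (Incident e x × Incident e′ x)
  commonEnd {e = e} (inj₁ p)                = fst e , at-fst refl , at-fst (sym p)
  commonEnd {e = e} (inj₂ (inj₁ p))         = fst e , at-fst refl , at-snd (sym p)
  commonEnd {e = e} (inj₂ (inj₂ (inj₁ p))) = snd e , at-snd refl , at-fst (sym p)
  commonEnd {e = e} (inj₂ (inj₂ (inj₂ p))) = snd e , at-snd refl , at-snd (sym p)

  shareEnd : Incident e x → Incident e′ x → ShareEnd e e′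
  shareEnd (at-fst p) (at-fst q) = inj₁ (trans p (sym q))
  shareEnd (at-fst p) (at-snd q) = inj₂ (inj₁ (trans p (sym q)))
  shareEnd (at-snd p) (at-fst q) = inj₂ (inj₂ (inj₁ (trans p (sym q))))
  shareEnd (at-snd p) (at-snd q) = inj₂ (inj₂ (inj₂ (trans p (sym q))))

  LAdj-sym : LAdj e e′ → LAdj e′ e
  LAdj-sym {e = e} {e′ = e′} (¬same , share) =
    let _ , e∋x , e′∋x = commonEnd {e = e} {e′ = e′} share
    in ¬same ∘ SameEdge-sym {e = e′} {e′ = e} , shareEnd e′∋x e∋x

  LWalk-snoc : ∀ {j} → LWalk e e′ j → LAdj e′ e₁ → LWalk e e₁ (suc j)
  LWalk-snoc {e = e} {e′ = e′} {e₁ = e₁} (here same) e′~e₁ =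
    step {e₁ = e₁} (subst (λ d → LAdj d e₁) (sym (SameEdge⇒≡ {e = e} {e′ = e′} same)) e′~e₁)
                   (here (refl , refl))
  LWalk-snoc (step e~e₂ walk) e′~e₁ = step e~e₂ (LWalk-snoc walk e′~e₁)

  LWalk-reverse : ∀ {j} → LWalk e e′ j → LWalk e′ e j
  LWalk-reverse {e = e} {e′ = e′} (here same) = here (SameEdge-sym {e = e} {e′ = e′} same)
  LWalk-reverse {e = e} (step {e₁ = e₁} e~e₁ walk) =
    LWalk-snoc (LWalk-reverse walk) (LAdj-sym {e = e} {e′ = e₁} e~e₁)

  DistLE-sym : ∀ {j} → DistLE e e′ j → DistLE e′ e j
  DistLE-sym (i , i≤j , walk) = i , i≤j , LWalk-reverse walk

  neighbours : Vertex G → List (Vertex G)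
  neighbours x = filter (λ y → adj G x y ≟ᵇ true) (allFin (n G))

  ∈-neighbours⁺ : adj G x y ≡ true → y ∈ₗ neighbours x
  ∈-neighbours⁺ {x = x} = ∈-filter⁺ (λ y → adj G x y ≟ᵇ true) (∈-allFin _)

  ∈-neighbours⁻ : y ∈ₗ neighbours x → adj G x y ≡ true
  ∈-neighbours⁻ {x = x} = proj₂ ∘ ∈-filter⁻ (λ y → adj G x y ≟ᵇ true) {xs = allFin (n G)}

  leaf-unique : deg G u ≡ 1 → Incident e₁ u → Incident e₂ u → e₁ ≡ e₂
  leaf-unique leaf e₁∋u e₂∋u
    with y₁ , e₁-joins ← otherEnd e₁∋u | y₂ , e₂-joins ← otherEnd e₂∋u
    with refl ← ∈-length1⇒≡ leaf (∈-neighbours⁺ (joins-adj e₁-joins)) (∈-neighbours⁺ (joins-adj e₂-joins))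
    = joins-unique e₁-joins e₂-joins

  -- The edges other i need not be distinct from each other or from ε.
  record OtherEdgesAt (x : Vertex G) (ε : Edge G) : Set where
    field
      other    : Fin 2 → Edge G
      incident : ∀ i → Incident (other i) x
      complete : ∀ {e′} → Incident e′ x → e′ ≢ ε → ∃[ i ] e′ ≡ other i

  -- Opaque, like freeSide below: only the fields are ever used, and unfolding the
  -- construction during unification makes type checking very slow.
  opaque
    otherEdgesAt : Subcubic G → Incident ε x → OtherEdgesAt x ε
    otherEdgesAt {ε = ε} {x = x} subcubic ε∋x
      with z , ε-joins ← otherEnd ε∋x
      with y , y∈ , others-among-y ←
             atMostTwoOthers (neighbours x) (subcubic x) (∈-neighbours⁺ (joins-adj ε-joins))
      = record
        { other    = proj₁ ∘ edgeTo
        ; incident = joins⇒incidentˡ ∘ proj₂ ∘ edgeTo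
        ; complete = complete
        }
      where
      edgeTo : ∀ i → Σ[ e ∈ Edge G ] Joins e x (y i)
      edgeTo i = joiningEdge (∈-neighbours⁻ (y∈ i))

      complete : Incident e′ x → e′ ≢ ε → ∃[ i ] e′ ≡ proj₁ (edgeTo i)
      complete e′∋x e′≢ε
        with y′ , e′-joins ← otherEnd e′∋x
        with i , refl ← others-among-y (∈-neighbours⁺ (joins-adj e′-joins))
                          (λ { refl → e′≢ε (joins-unique e′-joins ε-joins) })
        = i , joins-unique e′-joins (proj₂ (edgeTo i))

colours : Maybe (Label k) → Subset k
colours nothing  = ∅
colours (just L) = proj₁ L

∣colours∣≤2 : (c : Maybe (Label k)) → ∣ colours c ∣ ≤ 2
∣colours∣≤2 {k = k} nothing = ≤-trans (≤-reflexive (∣⊥∣≡0 k)) z≤n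
∣colours∣≤2 (just L)        = ≤-reflexive (proj₂ L)

module _ {G : Graph} {k : ℕ} {f : PartialLabelling G k} where

  private
    variable
      e e′ e₁ e₂ : Edge G
      x : Vertex G
      L L′ : Label k

  assign-just : assign f e L e′ ≡ just L′ → (SameEdge e e′ × L ≡ L′) ⊎ (¬ SameEdge e e′ × f e′ ≡ just L′)
  assign-just {e = e} {e′ = e′} assigned with sameEdge? e e′
  ... | yes same = inj₁ (same , just-injective assigned)
  ... | no ¬same = inj₂ (¬same , assigned)

  SameEdge⇒colours≡ : SameEdge e₁ e′ → f e′ ≡ just L′ → colours (f e₁) ≡ proj₁ L′
  SameEdge⇒colours≡ {e₁ = e₁} {e′ = e′} same f-e′ =
    cong colours (trans (cong f (SameEdge⇒≡ {e = e₁} {e′ = e′} same)) f-e′)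

  near-bounds⇒¬DistLE : (∀ {e₁} → LAdj e e₁ → ∣ proj₁ L ∩ colours (f e₁) ∣ < 1) →
            (∀ {e₁ e₂} → LAdj e e₁ → LAdj e₁ e₂ → ¬ SameEdge e e₂ → ∣ proj₁ L ∩ colours (f e₂) ∣ < 2) →
            ¬ SameEdge e e′ → f e′ ≡ just L′ → ¬ DistLE e e′ ∣ proj₁ L ∩ proj₁ L′ ∣
  near-bounds⇒¬DistLE _ _ ¬same _ (0 , _ , here same) = ¬same same
  near-bounds⇒¬DistLE {L = L} near₁ _ _ f-e′ (1 , 1≤ , step {e₁ = e₁} e~e₁ (here same)) =
    <⇒≱ (subst (λ c → ∣ proj₁ L ∩ c ∣ < 1) (SameEdge⇒colours≡ {e₁ = e₁} same f-e′) (near₁ e~e₁)) 1≤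
  near-bounds⇒¬DistLE {L = L} _ near₂ ¬same f-e′
                      (2 , 2≤ , step {e₁ = e₁} e~e₁ (step {e₁ = e₂} e₁~e₂ (here same))) =
    <⇒≱ (subst (λ c → ∣ proj₁ L ∩ c ∣ < 2) (SameEdge⇒colours≡ {e₁ = e₂} same f-e′)
               (near₂ {e₁} {e₂} e~e₁ e₁~e₂ λ (p , q) → ¬same (trans p (proj₁ same) , trans q (proj₂ same))))
        2≤
  near-bounds⇒¬DistLE {L = L} {L′ = L′} _ _ _ _ (suc (suc (suc j)) , 3+j≤ , _) =
    ≤⇒≯ (≤-trans (∣p∩q∣≤∣p∣ (proj₁ L) (proj₁ L′)) (≤-reflexive (proj₂ L)))
        (≤-trans (s≤s (s≤s (s≤s z≤n))) 3+j≤)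

  module _ (f-2tone : IsPartial2Tone f) where

    adjacent⇒disjoint : LAdj e₁ e₂ → Empty (colours (f e₁) ∩ colours (f e₂))
    adjacent⇒disjoint {e₁ = e₁} {e₂ = e₂} e₁~e₂ (_ , x∈)
      with f e₁ in f-e₁ | f e₂ in f-e₂ | x∈p∩q⁻ (colours (f e₁)) (colours (f e₂)) x∈
    ... | just L₁ | just L₂ | x∈L₁ , x∈L₂ =
      f-2tone e₁ e₂ L₁ L₂ (proj₁ e₁~e₂) f-e₁ f-e₂
        (1 , x∈p⇒0<∣p∣ (x∈p∩q⁺ (x∈L₁ , x∈L₂)) , step {e₁ = e₂} e₁~e₂ (here (refl , refl)))
    ... | nothing | _       | x∈∅ , _ = ∉⊥ x∈∅
    ... | just _  | nothing | _ , x∈∅ = ∉⊥ x∈∅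

    incident⇒equal-or-disjoint : Incident e₁ x → Incident e₂ x →
      colours (f e₁) ≡ colours (f e₂) ⊎ Empty (colours (f e₁) ∩ colours (f e₂))
    incident⇒equal-or-disjoint {e₁ = e₁} {e₂ = e₂} e₁∋x e₂∋x with sameEdge? e₁ e₂
    ... | yes same = inj₁ (cong (colours ∘ f) (SameEdge⇒≡ {e = e₁} {e′ = e₂} same))
    ... | no ¬same = inj₂ (adjacent⇒disjoint {e₁ = e₁} {e₂ = e₂} (¬same , shareEnd e₁∋x e₂∋x))

    assign-2tone : (∀ {e′ L′} → ¬ SameEdge e e′ → f e′ ≡ just L′ → ¬ DistLE e e′ ∣ proj₁ L ∩ proj₁ L′ ∣) →
                   IsPartial2Tone (assign f e L)
    assign-2tone {e = e} {L = L} no-conflict e₁ e₂ L₁ L₂ ¬same₁₂ assigned₁ assigned₂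
      with assign-just {e = e} {e′ = e₁} assigned₁ | assign-just {e = e} {e′ = e₂} assigned₂
    ... | inj₁ (same₁ , refl) | inj₁ (same₂ , refl) =
      ⊥-elim (¬same₁₂ (trans (sym (proj₁ same₁)) (proj₁ same₂) , trans (sym (proj₂ same₁)) (proj₂ same₂)))
    ... | inj₁ (same₁ , refl) | inj₂ (¬same₂ , f-e₂) =
      subst (λ d → ¬ DistLE d e₂ _) (SameEdge⇒≡ {e = e} {e′ = e₁} same₁) (no-conflict ¬same₂ f-e₂)
    ... | inj₂ (¬same₁ , f-e₁) | inj₁ (same₂ , refl) =
      subst (λ d → ¬ DistLE e₁ d _) (SameEdge⇒≡ {e = e} {e′ = e₂} same₂)
        (no-conflict ¬same₁ f-e₁ ∘ subst (DistLE e e₁) (cong ∣_∣ (∩-comm (proj₁ L₁) (proj₁ L))) ∘ DistLE-sym)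
    ... | inj₂ (_ , f-e₁) | inj₂ (_ , f-e₂) = f-2tone e₁ e₂ L₁ L₂ ¬same₁₂ f-e₁ f-e₂

module LeafEdge {G : Graph} (subcubic : Subcubic G) {k : ℕ} (7≤k : 7 ≤ k)
                {f : PartialLabelling G k} (f-2tone : IsPartial2Tone f)
                {e : Edge G} {u v : Vertex G} (e-joins : Joins e u v) (u-leaf : deg G u ≡ 1) where

  open OtherEdgesAt

  atV : OtherEdgesAt v e
  atV = otherEdgesAt subcubic (joins⇒incidentʳ e-joins)

  far : Fin 2 → Vertex G
  far i = proj₁ (otherEnd (incident atV i))

  far-joins : ∀ i → Joins (other atV i) v (far i)
  far-joins i = proj₂ (otherEnd (incident atV i))

  atFar : ∀ i → OtherEdgesAt (far i) (other atV i)
  atFar i = otherEdgesAt subcubic (joins⇒incidentʳ (far-joins i))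

  adjacent⇒atV : ∀ {e₁} → LAdj e e₁ → ∃[ i ] e₁ ≡ other atV i
  adjacent⇒atV {e₁} (¬same , share) with x , e∋x , e₁∋x ← commonEnd {e = e} {e′ = e₁} share
    with incident⇒end e-joins e∋x
  ... | inj₁ refl = ⊥-elim (¬same (≡⇒SameEdge (leaf-unique u-leaf e∋x e₁∋x)))
  ... | inj₂ refl = complete atV e₁∋x (¬SameEdge⇒≢ ¬same)

  distance2⇒atV⊎atFar : ∀ {e₁ e₂} → LAdj e e₁ → LAdj e₁ e₂ → ¬ SameEdge e e₂ →
                         (∃[ i ] e₂ ≡ other atV i) ⊎ (∃[ i ] ∃[ j ] e₂ ≡ other (atFar i) j)
  distance2⇒atV⊎atFar {e₁} {e₂} e~e₁ (¬same₁₂ , share) ¬same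
    with i , e₁≡eᵢ ← adjacent⇒atV {e₁} e~e₁
    with x , eᵢ∋x , e₂∋x ←
           commonEnd {e = other atV i} {e′ = e₂} (subst (λ d → ShareEnd d e₂) e₁≡eᵢ share)
    with incident⇒end (far-joins i) eᵢ∋x
  ... | inj₁ refl = inj₁ (complete atV e₂∋x (¬SameEdge⇒≢ ¬same))
  ... | inj₂ refl =
    inj₂ (i , complete (atFar i) e₂∋x (¬SameEdge⇒≢ (subst (λ d → ¬ SameEdge d e₂) e₁≡eᵢ ¬same₁₂)))

  forbidden : Subset k
  forbidden = colours (f (other atV zero)) ∪ colours (f (other atV (suc zero)))

  ∉forbidden : ∀ {a} → a ∉ forbidden → ∀ i → a ∉ colours (f (other atV i))
  ∉forbidden a∉ zero       = a∉ ∘ p⊆p∪q _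
  ∉forbidden a∉ (suc zero) = a∉ ∘ q⊆p∪q _ _

  3+∣forbidden∣≤k : 3 + ∣ forbidden ∣ ≤ k
  3+∣forbidden∣≤k = ≤-trans (+-monoʳ-≤ 3 (≤-trans (∣p∪q∣≤∣p∣+∣q∣ (colours (f e₀)) (colours (f e₁)))
                                                  (+-mono-≤ (∣colours∣≤2 (f e₀)) (∣colours∣≤2 (f e₁)))))
                            7≤k
    where
    e₀ = other atV zero
    e₁ = other atV (suc zero)

  CoveredAt : Fin 2 → Fin k → Fin k → Set
  CoveredAt i = CoveredBy (λ j → colours (f (other (atFar i) j)))

  coveredAt-matching : ∀ i → IsMatching (CoveredAt i)
  coveredAt-matching i = coveredBy-matching (λ j → ∣colours∣≤2 (f (other (atFar i) j)))
    (λ j j′ → incident⇒equal-or-disjoint f-2tone (incident (atFar i) j) (incident (atFar i) j′))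

  opaque
    freeSide : UncoveredSide (_∉ forbidden) (CoveredAt zero) (CoveredAt (suc zero))
    freeSide =
      let a , b , c , a≢b , a≢c , b≢c , a∉ , b∉ , c∉ = three-outside forbidden 3+∣forbidden∣≤k
      in uncoveredSide (coveredBy? _) (coveredBy? _) coveredBy-sym coveredBy-sym
                       (coveredAt-matching zero) (coveredAt-matching (suc zero)) a∉ b∉ c∉ a≢b a≢c b≢c

  open UncoveredSide freeSide

  ¬CoveredAt : ∀ i → ¬ CoveredAt i a b
  ¬CoveredAt zero       = ¬Rab
  ¬CoveredAt (suc zero) = ¬Sab

  label : Label k
  label = pair a b , ∣pair∣≡2 a≢b

  disjoint-atV : ∀ i → ∣ pair a b ∩ colours (f (other atV i)) ∣ < 1
  disjoint-atV i = s≤s (≤-reflexive (pair-disjoint (∉forbidden Pa i) (∉forbidden Pb i)))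

  near₁ : ∀ {e₁} → LAdj e e₁ → ∣ pair a b ∩ colours (f e₁) ∣ < 1
  near₁ {e₁} e~e₁ =
    let i , e₁≡eᵢ = adjacent⇒atV {e₁} e~e₁
    in subst (λ d → ∣ pair a b ∩ colours (f d) ∣ < 1) (sym e₁≡eᵢ) (disjoint-atV i)

  near₂ : ∀ {e₁ e₂} → LAdj e e₁ → LAdj e₁ e₂ → ¬ SameEdge e e₂ → ∣ pair a b ∩ colours (f e₂) ∣ < 2
  near₂ {e₁} {e₂} e~e₁ e₁~e₂ ¬same with distance2⇒atV⊎atFar {e₁} {e₂} e~e₁ e₁~e₂ ¬same
  ... | inj₁ (i , e₂≡eᵢ) =
    subst (λ d → ∣ pair a b ∩ colours (f d) ∣ < 2) (sym e₂≡eᵢ) (m<n⇒m<1+n (disjoint-atV i))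
  ... | inj₂ (i , j , e₂≡eᵢⱼ) =
    ¬Covers⇒∣pair∩p∣<2 a≢b λ covers →
      ¬CoveredAt i (j , subst (λ d → Covers (colours (f d)) a b) e₂≡eᵢⱼ covers)

  extendable : Extendable f e
  extendable = label , assign-2tone f-2tone
    (near-bounds⇒¬DistLE {f = f} {e = e} {L = label} near₁ (λ {e₁} {e₂} → near₂ {e₁} {e₂}))

-- The argument never uses that e is uncoloured: a previous label of e is simply overwritten.
mainTheorem11 : (G : Graph) → Subcubic G →
    (f : PartialLabelling G 7) → IsPartial2Tone f →
    (e : Edge G) → f e ≡ nothing →
    (deg G (Edge.fst e) ≡ 1 ⊎ deg G (Edge.snd e) ≡ 1) →
    Extendable f e
mainTheorem11 G subcubic f f-2tone e _ (inj₁ fst-leaf) =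
  LeafEdge.extendable subcubic ≤-refl f-2tone {e = e} (forwards refl refl) fst-leaf
mainTheorem11 G subcubic f f-2tone e _ (inj₂ snd-leaf) =
  LeafEdge.extendable subcubic ≤-refl f-2tone {e = e} (backwards refl refl) snd-leaf
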